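{- Let $f=f(x_1,\ldots,x_n)$ be a positive non-canalyzing Boolean function such that for each variable $x_i$ both restrictions $f_{|x_i=0}$ and $f_{|x_i=1}$ are canalyzing. Then the number of extremal points of $f$ is at least $n+2$.
   Context: $B=\{0,1\}$; $\mathbf{x}\preceq\mathbf{y}$ means $(\mathbf{x})_i=1\Rightarrow(\mathbf{y})_i=1$ for all $i$. $f$ is positive if $f(\mathbf{x})=1$ and $\mathbf{x}\preceq\mathbf{y}$ imply $f(\mathbf{y})=1$. Extremal points: maximal false points and minimal true points of $f$ under $\preceq$. $f_{|x_i=\alpha}$ is the function of the remaining variables obtained by fixing $x_i=\alpha$. A Boolean function $g$ of variables $x_1,\dots,x_m$ is canalyzing if there is $j$ such that $g_{|x_j=0}$ or $g_{|x_j=1}$ is a constant function. -}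

module Defs where

open import Data.Bool using (Bool; true; false)
open import Data.Nat using (ℕ; zero; suc)
open import Data.Fin using (Fin)
open import Data.Vec using (Vec; lookup; insertAt)
open import Data.Product using (Σ; _×_; ∃)
open import Data.Sum using (_⊎_)
open import Data.Empty using (⊥)
open import Relation.Binary.PropositionalEquality using (_≡_)

BoolFun : ℕ → Set
BoolFun n = Vec Bool n → Bool

_≼_ : ∀ {n} → Vec Bool n → Vec Bool n → Set
x ≼ y = ∀ i → lookup x i ≡ true → lookup y i ≡ true

Positive : ∀ {n} → BoolFun n → Set
Positive f = ∀ x y → f x ≡ true → x ≼ y → f y ≡ true

MaxFalse : ∀ {n} → BoolFun n → Vec Bool n → Set
MaxFalse f x = f x ≡ false × (∀ y → x ≼ y → f y ≡ false → y ≡ x)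

MinTrue : ∀ {n} → BoolFun n → Vec Bool n → Set
MinTrue f x = f x ≡ true × (∀ y → y ≼ x → f y ≡ true → y ≡ x)

Extremal : ∀ {n} → BoolFun n → Vec Bool n → Set
Extremal f x = MaxFalse f x ⊎ MinTrue f x

restrict : ∀ {n} → BoolFun (suc n) → Fin (suc n) → Bool → BoolFun n
restrict f i a y = f (insertAt y i a)

Constant : ∀ {n} → BoolFun n → Set
Constant g = Σ Bool λ c → ∀ x → g x ≡ c

Canalyzing : ∀ {m} → BoolFun m → Set
Canalyzing {zero} g = ⊥
Canalyzing {suc k} g = Σ (Fin (suc k)) λ j → Constant (restrict g j false) ⊎ Constant (restrict g j true)

-- Positivity and non-canalyzation force f(e_i) = 0 and f(1 - e_i) = 1 for every unit vector e_i.
-- Hence the indicator of a pair {i,j} (i = j allowed) is a minimal true point when it is true, its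
-- complement is a maximal false point when it is false, and every true pair meets every false pair.
-- A canalyzing variable of f|x_i=1 (resp. f|x_i=0) provides a true (resp. false) pair through i.
-- For n ≥ 5 a fifth vertex shows that the false pairs pairwise intersect, so they form a star (a
-- triangle is ruled out by a fourth vertex), and its centre c is also the centre of the true pairs;
-- the pairs {c,k} and the complements of the pairs {c,k} give 2(n-1) ≥ n+2 extremal points. For
-- n = 3, 4 every pair is the complement of a pair, hence extremal; for n ≤ 2 no such f exists.
module Submission where

open import Defs
open import Data.Bool using (Bool; true; false; not)
import Data.Bool as Bool
open import Data.Bool.Properties using (not-¬; ¬-not; ∨-comm)
open import Data.Nat using (ℕ; zero; suc; _+_; _≤_; _<_; s≤s; z≤n)
open import Data.Nat.Properties using (<⇒≱; <⇒≤; +-suc; +-monoʳ-≤; ≤-trans; ≤-reflexive; ≤-refl; n≤1+n)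
open import Data.Fin using (Fin; zero; suc; punchIn; _≟_; #_)
open import Data.Fin.Properties
  using (all?; ¬∀⟶∃¬; injective⇒≤; punchInᵢ≢i; punchOut-punchIn; punchIn-injective)
open import Data.Vec using (Vec; lookup; tabulate; insertAt; removeAt; replicate)
open import Function using (_∘_)
open import Data.Vec.Properties
  using ( lookup∘tabulate; tabulate∘lookup; tabulate-cong; lookup-replicate
        ; insertAt-lookup; insertAt-removeAt; removeAt-punchOut; ≡-dec)
open import Data.List using (List; []; _∷_; length; _++_)
import Data.List as List
open import Data.List.Properties using (length-++; length-tabulate)
open import Data.List.Relation.Unary.All using (All; []; _∷_)
import Data.List.Relation.Unary.All as All
open import Data.List.Relation.Unary.All.Properties using (¬Any⇒All¬)
import Data.List.Relation.Unary.All.Properties as All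
open import Data.List.Relation.Unary.Any using (index; any?)
open import Data.List.Relation.Unary.Any.Properties using (lookup-index)
open import Data.List.Relation.Unary.Unique.Propositional using (Unique)
import Data.List.Relation.Unary.Unique.Propositional.Properties as Unique
import Data.List.Relation.Unary.Unique.DecPropositional as UniqueDec
open import Data.Product using (Σ; _×_; _,_; ∃; ∃₂; proj₁; proj₂; map₂)
open import Data.Sum using (_⊎_; inj₁; inj₂; [_,_]′)
open import Data.Empty using (⊥; ⊥-elim)
open import Level using (0ℓ)
open import Relation.Nullary using (¬_; Dec; yes; no; does)
open import Relation.Nullary.Decidable using (_⊎-dec_; _→-dec_; dec-true; dec-false; decidable-stable; from-yes)
open import Relation.Binary using (Rel; Symmetric; Irreflexive; Decidable)
open import Relation.Binary.PropositionalEquality using (_≡_; _≢_; refl; sym; trans; cong; cong₂; subst)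

private
  variable
    m n : ℕ
    α γ : Bool
    x y : Vec Bool n

_∈⟨_,_⟩ : Fin n → Fin n → Fin n → Set
v ∈⟨ i , j ⟩ = v ≡ i ⊎ v ≡ j

_∈?⟨_,_⟩ : (v i j : Fin n) → Dec (v ∈⟨ i , j ⟩)
v ∈?⟨ i , j ⟩ = v ≟ i ⊎-dec v ≟ j

∃-avoiding : (xs : List (Fin n)) → length xs < n → ∃ λ v → All (v ≢_) xs
∃-avoiding {n} xs |xs|<n with all? (λ v → any? (v ≟_) xs)
... | yes all∈xs = ⊥-elim (<⇒≱ |xs|<n (injective⇒≤ index-injective))
  where
  index-injective : ∀ {v w} → index (all∈xs v) ≡ index (all∈xs w) → v ≡ w
  index-injective {v} {w} e =
    trans (lookup-index (all∈xs v)) (trans (cong (List.lookup xs) e) (sym (lookup-index (all∈xs w))))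
... | no ¬all∈xs = map₂ (¬Any⇒All¬ xs) (¬∀⟶∃¬ n _ (λ v → any? (v ≟_) xs) ¬all∈xs)

-- A relation R on Fin n is read as the graph with an edge {i,j} for each R i j.

module _ {n : ℕ} where

  private
    variable
      c i j k l p q v w : Fin n
      R S : Rel (Fin n) 0ℓ

  Covering : Rel (Fin n) 0ℓ → Set
  Covering R = ∀ i → ∃ (R i)

  CrossIntersecting : Rel (Fin n) 0ℓ → Rel (Fin n) 0ℓ → Set
  CrossIntersecting R S = ∀ {i j k l} → R i j → S k l → ∃ λ v → v ∈⟨ i , j ⟩ × v ∈⟨ k , l ⟩

  Center : Rel (Fin n) 0ℓ → Fin n → Set
  Center R c = ∀ p q → R p q → c ∈⟨ p , q ⟩

  crossIntersecting-swap : CrossIntersecting R S → CrossIntersecting S R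
  crossIntersecting-swap R×S s r with R×S r s
  ... | u , u∈r , u∈s = u , u∈s , u∈r

  other-end : CrossIntersecting R S → R i j → S v w → ¬ v ∈⟨ i , j ⟩ → w ∈⟨ i , j ⟩
  other-end R×S rij svw v∉ij with R×S rij svw
  ... | _ , u∈ij , inj₁ refl = ⊥-elim (v∉ij u∈ij)
  ... | _ , u∈ij , inj₂ refl = u∈ij

  -- a fifth vertex sees both edges through the other end of its R-edge
  intersecting : 5 ≤ n → Covering R → CrossIntersecting S R → CrossIntersecting S S
  intersecting 5≤n R-cov S×R {i} {j} {k} {l} sij skl with ∃-avoiding (i ∷ j ∷ k ∷ l ∷ []) 5≤n
  ... | v , v≢i ∷ v≢j ∷ v≢k ∷ v≢l ∷ [] with R-cov v
  ... | w , rvw = w , other-end S×R sij rvw [ v≢i , v≢j ]′ , other-end S×R skl rvw [ v≢k , v≢l ]′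

  center-neighbour : Symmetric R → Covering R → Center R c → k ≢ c → R c k
  center-neighbour {c = c} {k = k} R-sym R-cov center k≢c with R-cov k
  ... | w , rkw with center k w rkw
  ...   | inj₁ c≡k = ⊥-elim (k≢c (sym c≡k))
  ...   | inj₂ refl = R-sym rkw

  center-transfer : 4 ≤ n → CrossIntersecting R S → (∀ k → k ≢ c → S c k) → Center R c
  center-transfer {c = c} 4≤n R×S S-star p q rpq with c ∈?⟨ p , q ⟩
  ... | yes c∈pq = c∈pq
  ... | no c∉pq with ∃-avoiding (p ∷ q ∷ c ∷ []) 4≤n
  ...   | k , k≢p ∷ k≢q ∷ k≢c ∷ [] = ⊥-elim ([ k≢p , k≢q ]′ (other-end R×S rpq (S-star k k≢c) c∉pq))

  module _ {S : Rel (Fin n) 0ℓ} (S-sym : Symmetric S) (S-irr : Irreflexive _≡_ S) (S×S : CrossIntersecting S S) where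

    center? : Decidable S → ∀ c → Dec (Center S c)
    center? S? c = all? λ p → all? λ q → S? p q →-dec c ∈?⟨ p , q ⟩

    edge-avoiding : Decidable S → ¬ Center S c → ∃₂ λ p q → S p q × ¬ c ∈⟨ p , q ⟩
    edge-avoiding {c = c} S? ¬center
      with ¬∀⟶∃¬ n _ (λ p → all? λ q → S? p q →-dec c ∈?⟨ p , q ⟩) ¬center
    ... | p , ¬center-p with ¬∀⟶∃¬ n _ (λ q → S? p q →-dec c ∈?⟨ p , q ⟩) ¬center-p
    ...   | q , ¬center-pq with S? p q
    ...     | yes spq = p , q , spq , λ c∈pq → ¬center-pq λ _ → c∈pq
    ...     | no ¬spq = ⊥-elim (¬center-pq λ spq → ⊥-elim (¬spq spq))

    edge-through : S i j → S p q → ¬ i ∈⟨ p , q ⟩ → ∃ λ k → S j k × k ≢ i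
    edge-through {p = p} {q = q} sij spq i∉pq with S×S sij spq
    ... | _ , inj₁ refl , u∈pq = ⊥-elim (i∉pq u∈pq)
    ... | _ , inj₂ refl , inj₁ refl = q , spq , λ q≡i → i∉pq (inj₂ (sym q≡i))
    ... | _ , inj₂ refl , inj₂ refl = p , S-sym spq , λ p≡i → i∉pq (inj₁ (sym p≡i))

    triangle-closes : S i j → S j k → S i l → k ≢ i → l ≢ j → k ≡ l
    triangle-closes sij sjk sil k≢i l≢j with S×S sjk sil
    ... | _ , inj₁ refl , inj₁ refl = ⊥-elim (S-irr refl sij)
    ... | _ , inj₁ refl , inj₂ refl = ⊥-elim (l≢j refl)
    ... | _ , inj₂ refl , inj₁ refl = ⊥-elim (k≢i refl)
    ... | _ , inj₂ refl , inj₂ refl = refl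

    no-triangle : 4 ≤ n → Covering S → S i j → S j k → S i k → ⊥
    no-triangle {i = i} {j = j} {k = k} 4≤n S-cov sij sjk sik with ∃-avoiding (i ∷ j ∷ k ∷ []) 4≤n
    ... | v , v≢i ∷ v≢j ∷ v≢k ∷ [] with S-cov v
    ... | w , svw
      with other-end S×S sij svw [ v≢i , v≢j ]′
         | other-end S×S sjk svw [ v≢j , v≢k ]′
         | other-end S×S sik svw [ v≢i , v≢k ]′
    ... | inj₁ refl | inj₁ i≡j | _ = S-irr i≡j sij
    ... | inj₁ refl | inj₂ i≡k | _ = S-irr i≡k sik
    ... | inj₂ refl | _ | inj₁ j≡i = S-irr (sym j≡i) sij
    ... | inj₂ refl | _ | inj₂ j≡k = S-irr j≡k sjk

    edge-center : 4 ≤ n → Decidable S → Covering S → S i j → Center S i ⊎ Center S j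
    edge-center {i = i} {j = j} 4≤n S? S-cov sij with center? S? i | center? S? j
    ... | yes center-i | _ = inj₁ center-i
    ... | no _ | yes center-j = inj₂ center-j
    ... | no ¬center-i | no ¬center-j with edge-avoiding S? ¬center-i | edge-avoiding S? ¬center-j
    ... | _ , _ , s , i∉ | _ , _ , s′ , j∉ with edge-through sij s i∉ | edge-through (S-sym sij) s′ j∉
    ... | k , sjk , k≢i | l , sil , l≢j =
      ⊥-elim (no-triangle 4≤n S-cov sij sjk (subst (S i) (sym (triangle-closes sij sjk sil k≢i l≢j)) sil))

    star : 4 ≤ n → Decidable S → Covering S → ∃ (Center S)
    star 4≤n@(s≤s _) S? S-cov with S-cov zero
    ... | j , s0j = [ (zero ,_) , (j ,_) ]′ (edge-center 4≤n S? S-cov s0j)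

  common-star : 5 ≤ n → (R S : Rel (Fin n) 0ℓ) →
    Symmetric R → Covering R → Symmetric S → Irreflexive _≡_ S → Decidable S → Covering S →
    CrossIntersecting R S → ∃ λ c → ∀ k → k ≢ c → R c k × S c k
  common-star 5≤n R S R-sym R-cov S-sym S-irr S? S-cov R×S
    with star S-sym S-irr (intersecting 5≤n R-cov (crossIntersecting-swap R×S)) (<⇒≤ 5≤n) S? S-cov
  ... | c , S-center = c , λ k k≢c → center-neighbour R-sym R-cov R-center k≢c , S-star k k≢c
    where
    S-star : ∀ k → k ≢ c → S c k
    S-star k = center-neighbour S-sym S-cov S-center
    R-center : Center R c
    R-center = center-transfer (<⇒≤ 5≤n) R×S S-star

private
  variable
    c i j k l p q : Fin n

-- Opaque, so that the vertices of pair i j can be inferred from lookup (pair i j) l.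
opaque
  pair : Fin n → Fin n → Vec Bool n
  pair i j = tabulate λ l → does (l ∈?⟨ i , j ⟩)

  copair : Fin n → Fin n → Vec Bool n
  copair i j = tabulate λ l → not (does (l ∈?⟨ i , j ⟩))

  pair-comm : pair i j ≡ pair j i
  pair-comm {i = i} {j} = tabulate-cong λ l → ∨-comm (does (l ≟ i)) (does (l ≟ j))

  copair-comm : copair i j ≡ copair j i
  copair-comm {i = i} {j} = tabulate-cong λ l → cong not (∨-comm (does (l ≟ i)) (does (l ≟ j)))

  pair-∈ : l ∈⟨ i , j ⟩ → lookup (pair i j) l ≡ true
  pair-∈ {l = l} {i} {j} l∈ij = trans (lookup∘tabulate _ l) (dec-true (l ∈?⟨ i , j ⟩) l∈ij)

  pair-∉ : ¬ l ∈⟨ i , j ⟩ → lookup (pair i j) l ≡ false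
  pair-∉ {l = l} {i} {j} l∉ij = trans (lookup∘tabulate _ l) (dec-false (l ∈?⟨ i , j ⟩) l∉ij)

  copair-∈ : l ∈⟨ i , j ⟩ → lookup (copair i j) l ≡ false
  copair-∈ {l = l} {i} {j} l∈ij = trans (lookup∘tabulate _ l) (cong not (dec-true (l ∈?⟨ i , j ⟩) l∈ij))

  copair-∉ : ¬ l ∈⟨ i , j ⟩ → lookup (copair i j) l ≡ true
  copair-∉ {l = l} {i} {j} l∉ij = trans (lookup∘tabulate _ l) (cong not (dec-false (l ∈?⟨ i , j ⟩) l∉ij))

pair-true : lookup (pair i j) l ≡ true → l ∈⟨ i , j ⟩
pair-true {i = i} {j} {l} ijl = decidable-stable (l ∈?⟨ i , j ⟩) λ l∉ij → not-¬ ijl (pair-∉ l∉ij)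

copair-false : lookup (copair i j) l ≡ false → l ∈⟨ i , j ⟩
copair-false {i = i} {j} {l} ijl = decidable-stable (l ∈?⟨ i , j ⟩) λ l∉ij → not-¬ (copair-∉ l∉ij) ijl

pair-≼ : ∀ x → lookup x i ≡ true → lookup x j ≡ true → pair i j ≼ x
pair-≼ {i = i} {j = j} x xi xj l ijl with pair-true {i = i} {j = j} {l = l} ijl
... | inj₁ refl = xi
... | inj₂ refl = xj

≼-pair : ∀ x → (∀ l → lookup x l ≡ true → l ∈⟨ i , j ⟩) → x ≼ pair i j
≼-pair x x⊆ij l xl = pair-∈ (x⊆ij l xl)

≼-copair : ∀ x → lookup x i ≡ false → lookup x j ≡ false → x ≼ copair i j
≼-copair {i = i} {j = j} x xi xj l xl =
  copair-∉ {i = i} {j = j} [ (λ { refl → not-¬ xl xi }) , (λ { refl → not-¬ xl xj }) ]′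

copair-≼ : ∀ x → (∀ l → lookup x l ≡ false → l ∈⟨ i , j ⟩) → copair i j ≼ x
copair-≼ x ij⊇x l ijl with lookup x l in xl
... | true = refl
... | false = ⊥-elim (not-¬ ijl (copair-∈ (ij⊇x l xl)))

copair-≼⁻ : ∀ x → copair i j ≼ x → lookup x l ≡ false → l ∈⟨ i , j ⟩
copair-≼⁻ {i = i} {j} {l = l} x ij≼x xl =
  decidable-stable (l ∈?⟨ i , j ⟩) λ l∉ij → not-¬ (ij≼x l (copair-∉ l∉ij)) xl

≼-antisym : x ≼ y → y ≼ x → x ≡ y
≼-antisym {x = x} {y} x≼y y≼x =
  trans (sym (tabulate∘lookup x)) (trans (tabulate-cong pointwise) (tabulate∘lookup y))
  where
  pointwise : ∀ l → lookup x l ≡ lookup y l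
  pointwise l with lookup x l in xl | lookup y l in yl
  ... | true  | true  = refl
  ... | false | false = refl
  ... | true  | false = ⊥-elim (not-¬ (x≼y l xl) yl)
  ... | false | true  = ⊥-elim (not-¬ (y≼x l yl) xl)

≼-replicate-true : ∀ x → x ≼ replicate n true
≼-replicate-true _ l _ = lookup-replicate l true

replicate-false-≼ : ∀ x → replicate n false ≼ x
replicate-false-≼ _ l e = ⊥-elim (not-¬ e (lookup-replicate l false))

Forces : BoolFun n → Fin n → Bool → Bool → Set
Forces g i α γ = ∀ z → lookup z i ≡ α → g z ≡ γ

restrict-removeAt : (g : BoolFun (suc n)) (z : Vec Bool (suc n)) →
  lookup z i ≡ α → restrict g i α (removeAt z i) ≡ g z
restrict-removeAt {i = i} g z refl = cong g (insertAt-removeAt z i)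

constant⇒forces : (g : BoolFun (suc n)) → Constant (restrict g i α) → Σ Bool (Forces g i α)
constant⇒forces {i = i} g (γ , const) = γ , λ z zi → trans (sym (restrict-removeAt g z zi)) (const (removeAt z i))

forces⇒constant : (g : BoolFun (suc n)) → Forces g i α γ → Constant (restrict g i α)
forces⇒constant {i = i} {α} g forced = _ , λ y → forced (insertAt y i α) (insertAt-lookup y i α)

forces⇒canalyzing : (g : BoolFun (suc n)) → Forces g i α γ → Canalyzing g
forces⇒canalyzing {i = i} {false} g forced = i , inj₁ (forces⇒constant g forced)
forces⇒canalyzing {i = i} {true}  g forced = i , inj₂ (forces⇒constant g forced)

canalyzing⇒forces : (g : BoolFun n) → Canalyzing g → ∃₂ λ j β → Σ Bool (Forces g j β)
canalyzing⇒forces {suc _} g (j , inj₁ const) = j , false , constant⇒forces g const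
canalyzing⇒forces {suc _} g (j , inj₂ const) = j , true , constant⇒forces g const

removeAt-punchIn : (z : Vec Bool (suc n)) (i : Fin (suc n)) (j : Fin n) →
  lookup (removeAt z i) j ≡ lookup z (punchIn i j)
removeAt-punchIn z i j =
  trans (cong (lookup (removeAt z i)) (sym (punchOut-punchIn i))) (removeAt-punchOut z (punchInᵢ≢i i j ∘ sym))

canalyzing-restrict : (g : BoolFun (suc n)) → Canalyzing (restrict g i α) →
  ∃ λ p → p ≢ i × ∃₂ λ β γ → ∀ z → lookup z i ≡ α → lookup z p ≡ β → g z ≡ γ
canalyzing-restrict {i = i} g can with canalyzing⇒forces (restrict g i _) can
... | j , β , γ , forced = punchIn i j , punchInᵢ≢i i j , β , γ , λ z zi zp →
  trans (sym (restrict-removeAt g z zi)) (forced (removeAt z i) (trans (removeAt-punchIn z i j) zp))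

pair-injectiveʳ : p ≢ c → pair c p ≡ pair c q → p ≡ q
pair-injectiveʳ {p = p} p≢c cp≡cq with pair-true (subst (λ z → lookup z p ≡ true) cp≡cq (pair-∈ (inj₂ refl)))
... | inj₁ p≡c = ⊥-elim (p≢c p≡c)
... | inj₂ p≡q = p≡q

copair-injectiveʳ : p ≢ c → copair c p ≡ copair c q → p ≡ q
copair-injectiveʳ {p = p} p≢c cp≡cq with copair-false (subst (λ z → lookup z p ≡ false) cp≡cq (copair-∈ (inj₂ refl)))
... | inj₁ p≡c = ⊥-elim (p≢c p≡c)
... | inj₂ p≡q = p≡q

positive-false : {f : BoolFun n} → Positive f → x ≼ y → f y ≡ false → f x ≡ false
positive-false {x = x} {f = f} f-pos x≼y fy with f x in fx
... | false = refl
... | true = ⊥-elim (not-¬ (f-pos _ _ fx x≼y) fy)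

binary-canalyzing : {f : BoolFun 2} → Positive f → Canalyzing f
binary-canalyzing {f} f-pos with f (pair (# 0) (# 0)) in f0 | f (pair (# 1) (# 1)) in f1
... | true  | _     = forces⇒canalyzing {α = true} f λ z z0 → f-pos _ _ f0 (pair-≼ z z0 z0)
... | false | true  = forces⇒canalyzing {α = true} f λ z z1 → f-pos _ _ f1 (pair-≼ z z1 z1)
... | false | false = forces⇒canalyzing {α = false} f λ z z0 → positive-false f-pos (≼-pair z (only-1 z z0)) f1
  where
  only-1 : ∀ z → lookup z (# 0) ≡ false → ∀ l → lookup z l ≡ true → l ∈⟨ # 1 , # 1 ⟩
  only-1 _ z0 zero zl = ⊥-elim (not-¬ zl z0)
  only-1 _ _ (suc zero) _ = inj₁ refl

suc[m]+2≤m+m : 3 ≤ m → suc m + 2 ≤ m + m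
suc[m]+2≤m+m {m} 3≤m = ≤-trans (≤-reflexive (sym (+-suc m 2))) (+-monoʳ-≤ m 3≤m)

module NonCanalyzing {m} {f : BoolFun (suc m)} (f-pos : Positive f) (f-nc : ¬ Canalyzing f) where

  unit-false : ∀ i → f (pair i i) ≡ false
  unit-false i with f (pair i i) in fii
  ... | false = refl
  ... | true = ⊥-elim (f-nc (forces⇒canalyzing {α = true} f λ z zi → f-pos _ _ fii (pair-≼ z zi zi)))

  counit-true : ∀ i → f (copair i i) ≡ true
  counit-true i with f (copair i i) in fii
  ... | true = refl
  ... | false =
    ⊥-elim (f-nc (forces⇒canalyzing {α = false} f λ z zi → positive-false f-pos (≼-copair z zi zi) fii))

  all-true : f (replicate _ true) ≡ true
  all-true = f-pos _ _ (counit-true zero) (≼-replicate-true (copair zero zero))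

  all-false : f (replicate _ false) ≡ false
  all-false = positive-false f-pos (replicate-false-≼ (pair zero zero)) (unit-false zero)

  true-below-pair : ∀ y → y ≼ pair i j → f y ≡ true → lookup y i ≡ true
  true-below-pair {i = i} {j} y y≼ij fy with lookup y i in yi
  ... | true = refl
  ... | false = ⊥-elim (not-¬ fy (positive-false f-pos (≼-pair y below-j) (unit-false j)))
    where
    below-j : ∀ l → lookup y l ≡ true → l ∈⟨ j , j ⟩
    below-j l yl with pair-true {i = i} {j = j} {l = l} (y≼ij l yl)
    ... | inj₁ refl = ⊥-elim (not-¬ yl yi)
    ... | inj₂ refl = inj₁ refl

  false-above-copair : ∀ y → copair i j ≼ y → f y ≡ false → lookup y i ≡ false
  false-above-copair {i = i} {j} y ij≼y fy with lookup y i in yi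
  ... | false = refl
  ... | true = ⊥-elim (not-¬ (f-pos _ _ (counit-true j) (copair-≼ y above-j)) fy)
    where
    above-j : ∀ l → lookup y l ≡ false → l ∈⟨ j , j ⟩
    above-j l yl with copair-≼⁻ y ij≼y yl
    ... | inj₁ refl = ⊥-elim (not-¬ yi yl)
    ... | inj₂ refl = inj₁ refl

  pair-minTrue : f (pair i j) ≡ true → MinTrue f (pair i j)
  pair-minTrue fij = fij , λ y y≼ij fy →
    ≼-antisym y≼ij (pair-≼ y (true-below-pair y y≼ij fy) (true-below-pair y (subst (y ≼_) pair-comm y≼ij) fy))

  copair-maxFalse : f (copair i j) ≡ false → MaxFalse f (copair i j)
  copair-maxFalse fij = fij , λ y ij≼y fy →
    ≼-antisym
      (≼-copair y (false-above-copair y ij≼y fy) (false-above-copair y (subst (_≼ y) copair-comm ij≼y) fy))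
      ij≼y

  pair-extremal : ∀ i j k l → pair i j ≡ copair k l → Extremal f (pair i j)
  pair-extremal i j k l ij≡kl with f (pair i j) Bool.≟ true
  ... | yes fij = inj₂ (pair-minTrue fij)
  ... | no fij≢true =
    inj₁ (subst (MaxFalse f) (sym ij≡kl) (copair-maxFalse (trans (cong f (sym ij≡kl)) (¬-not fij≢true))))

  TrueEdge FalseEdge : Rel (Fin (suc m)) 0ℓ
  TrueEdge i j = f (pair i j) ≡ true
  FalseEdge i j = f (copair i j) ≡ false

  trueEdge-sym : Symmetric TrueEdge
  trueEdge-sym = subst (λ z → f z ≡ true) pair-comm

  falseEdge-sym : Symmetric FalseEdge
  falseEdge-sym = subst (λ z → f z ≡ false) copair-comm

  falseEdge-irr : Irreflexive _≡_ FalseEdge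
  falseEdge-irr {i} refl fii = not-¬ (counit-true i) fii

  falseEdge? : Decidable FalseEdge
  falseEdge? i j = f (copair i j) Bool.≟ false

  true-false-crossIntersecting : CrossIntersecting TrueEdge FalseEdge
  true-false-crossIntersecting {i} {j} {k} {l} tij fkl with i ∈?⟨ k , l ⟩ | j ∈?⟨ k , l ⟩
  ... | yes i∈kl | _ = i , inj₁ refl , i∈kl
  ... | no _ | yes j∈kl = j , inj₂ refl , j∈kl
  ... | no i∉kl | no j∉kl = ⊥-elim (not-¬ (f-pos _ _ tij ij≼kl) fkl)
    where
    ij≼kl : pair i j ≼ copair k l
    ij≼kl v ijv = copair-∉ ([ (λ { refl → i∉kl }) , (λ { refl → j∉kl }) ]′ (pair-true ijv))

  trueEdge-covering : (∀ i → Canalyzing (restrict f i true)) → Covering TrueEdge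
  trueEdge-covering canalyzing i with canalyzing-restrict f (canalyzing i)
  ... | p , p≢i , false , true , forced =
    ⊥-elim (not-¬ (forced (pair i i) (pair-∈ (inj₁ refl)) (pair-∉ [ p≢i , p≢i ]′)) (unit-false i))
  ... | p , p≢i , false , false , forced =
    ⊥-elim (not-¬ (counit-true p) (forced (copair p p) (copair-∉ [ p≢i ∘ sym , p≢i ∘ sym ]′) (copair-∈ (inj₁ refl))))
  ... | p , _ , true , true , forced = p , forced (pair i p) (pair-∈ (inj₁ refl)) (pair-∈ (inj₂ refl))
  ... | p , _ , true , false , forced =
    ⊥-elim (not-¬ all-true (forced (replicate _ true) (lookup-replicate i true) (lookup-replicate p true)))

  falseEdge-covering : (∀ i → Canalyzing (restrict f i false)) → Covering FalseEdge
  falseEdge-covering canalyzing i with canalyzing-restrict f (canalyzing i)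
  ... | p , _ , false , false , forced = p , forced (copair i p) (copair-∈ (inj₁ refl)) (copair-∈ (inj₂ refl))
  ... | p , _ , false , true , forced =
    ⊥-elim (not-¬ (forced (replicate _ false) (lookup-replicate i false) (lookup-replicate p false)) all-false)
  ... | p , p≢i , true , false , forced =
    ⊥-elim (not-¬ (counit-true i) (forced (copair i i) (copair-∈ (inj₁ refl)) (copair-∉ [ p≢i , p≢i ]′)))
  ... | p , p≢i , true , true , forced =
    ⊥-elim (not-¬ (forced (pair p p) (pair-∉ [ p≢i ∘ sym , p≢i ∘ sym ]′) (pair-∈ (inj₁ refl))) (unit-false p))

  star-extremal-points : ∀ c → (∀ k → k ≢ c → TrueEdge c k × FalseEdge c k) →
    Σ (List (Vec Bool (suc m))) λ xs → length xs ≡ m + m × Unique xs × All (Extremal f) xs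
  star-extremal-points c star = pairs ++ copairs , |pairs++copairs| , unique , extremal
    where
    pairs copairs : List (Vec Bool (suc m))
    pairs = List.tabulate (pair c ∘ punchIn c)
    copairs = List.tabulate (copair c ∘ punchIn c)

    neighbour : ∀ k → TrueEdge c (punchIn c k) × FalseEdge c (punchIn c k)
    neighbour k = star (punchIn c k) (punchInᵢ≢i c k)

    pairs-true : All (λ z → f z ≡ true) pairs
    pairs-true = All.tabulate⁺ (proj₁ ∘ neighbour)

    copairs-false : All (λ z → f z ≡ false) copairs
    copairs-false = All.tabulate⁺ (proj₂ ∘ neighbour)

    |pairs++copairs| : length (pairs ++ copairs) ≡ m + m
    |pairs++copairs| =
      trans (length-++ pairs) (cong₂ _+_ (length-tabulate (pair c ∘ punchIn c)) (length-tabulate (copair c ∘ punchIn c)))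

    unique : Unique (pairs ++ copairs)
    unique = Unique.++⁺
      (Unique.tabulate⁺ (punchIn-injective c _ _ ∘ pair-injectiveʳ (punchInᵢ≢i c _)))
      (Unique.tabulate⁺ (punchIn-injective c _ _ ∘ copair-injectiveʳ (punchInᵢ≢i c _)))
      λ (∈pairs , ∈copairs) → not-¬ (All.lookup pairs-true ∈pairs) (All.lookup copairs-false ∈copairs)

    extremal : All (Extremal f) (pairs ++ copairs)
    extremal = All.++⁺
      (All.tabulate⁺ (inj₂ ∘ pair-minTrue ∘ proj₁ ∘ neighbour))
      (All.tabulate⁺ (inj₁ ∘ copair-maxFalse ∘ proj₂ ∘ neighbour))

  many-variables : 5 ≤ suc m → (∀ i α → Canalyzing (restrict f i α)) →
    Σ (List (Vec Bool (suc m))) λ xs → (suc m + 2 ≤ length xs) × Unique xs × All (Extremal f) xs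
  many-variables 5≤n@(s≤s 4≤m) canalyzing
    with common-star 5≤n TrueEdge FalseEdge
           trueEdge-sym (trueEdge-covering (λ i → canalyzing i true))
           falseEdge-sym falseEdge-irr falseEdge? (falseEdge-covering (λ i → canalyzing i false))
           true-false-crossIntersecting
  ... | c , star with star-extremal-points c star
  ... | xs , |xs| , unique , extremal =
    xs , subst (suc m + 2 ≤_) (sym |xs|) (suc[m]+2≤m+m (<⇒≤ 4≤m)) , unique , extremal

opaque
  unfolding pair

  three-variables : {f : BoolFun 3} → Positive f → ¬ Canalyzing f →
    Σ (List (Vec Bool 3)) λ xs → (5 ≤ length xs) × Unique xs × All (Extremal f) xs
  three-variables f-pos f-nc = xs , n≤1+n 5 , from-yes (UniqueDec.unique? (≡-dec Bool._≟_) xs) ,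
    pair-extremal (# 0) (# 1) (# 2) (# 2) refl ∷ pair-extremal (# 0) (# 2) (# 1) (# 1) refl ∷
    pair-extremal (# 1) (# 2) (# 0) (# 0) refl ∷ pair-extremal (# 0) (# 0) (# 1) (# 2) refl ∷
    pair-extremal (# 1) (# 1) (# 0) (# 2) refl ∷ pair-extremal (# 2) (# 2) (# 0) (# 1) refl ∷ []
    where
    open NonCanalyzing f-pos f-nc
    xs : List (Vec Bool 3)
    xs = pair (# 0) (# 1) ∷ pair (# 0) (# 2) ∷ pair (# 1) (# 2) ∷
         pair (# 0) (# 0) ∷ pair (# 1) (# 1) ∷ pair (# 2) (# 2) ∷ []

  four-variables : {f : BoolFun 4} → Positive f → ¬ Canalyzing f →
    Σ (List (Vec Bool 4)) λ xs → (6 ≤ length xs) × Unique xs × All (Extremal f) xs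
  four-variables f-pos f-nc = xs , ≤-refl , from-yes (UniqueDec.unique? (≡-dec Bool._≟_) xs) ,
    pair-extremal (# 0) (# 1) (# 2) (# 3) refl ∷ pair-extremal (# 0) (# 2) (# 1) (# 3) refl ∷
    pair-extremal (# 0) (# 3) (# 1) (# 2) refl ∷ pair-extremal (# 1) (# 2) (# 0) (# 3) refl ∷
    pair-extremal (# 1) (# 3) (# 0) (# 2) refl ∷ pair-extremal (# 2) (# 3) (# 0) (# 1) refl ∷ []
    where
    open NonCanalyzing f-pos f-nc
    xs : List (Vec Bool 4)
    xs = pair (# 0) (# 1) ∷ pair (# 0) (# 2) ∷ pair (# 0) (# 3) ∷
         pair (# 1) (# 2) ∷ pair (# 1) (# 3) ∷ pair (# 2) (# 3) ∷ []

lemma3 : (m : ℕ) (f : BoolFun (suc m)) → Positive f → ¬ Canalyzing f →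
    (∀ (i : Fin (suc m)) (a : Bool) → Canalyzing (restrict f i a)) →
    Σ (List (Vec Bool (suc m))) λ xs →
      (suc m + 2 ≤ length xs) × Unique xs × All (Extremal f) xs
lemma3 0 _ _ _ restrictions-canalyzing = ⊥-elim (restrictions-canalyzing zero true)
lemma3 1 _ f-pos f-nc _ = ⊥-elim (f-nc (binary-canalyzing f-pos))
lemma3 2 _ f-pos f-nc _ = three-variables f-pos f-nc
lemma3 3 _ f-pos f-nc _ = four-variables f-pos f-nc
lemma3 (suc (suc (suc (suc _)))) _ f-pos f-nc restrictions-canalyzing =
  NonCanalyzing.many-variables f-pos f-nc (s≤s (s≤s (s≤s (s≤s (s≤s z≤n))))) restrictions-canalyzing
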